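{- Let $a<a'$ be consecutive superabundant numbers such that $p(a')\ge p(a)$, where $p(m)$ denotes the largest prime factor of $m$. Then $\dfrac{\sigma(a)}{\varphi(a)}\le\dfrac{\sigma(a')}{\varphi(a')}$.
   Context: $\sigma(n)=\sum_{d\mid n}d$ and $\varphi$ is Euler's totient function. A positive integer $n$ is superabundant if $\sigma(n)/n>\sigma(m)/m$ for all positive integers $m<n$; consecutive means no superabundant number lies strictly between them. -}

module Defs where

open import Data.Nat using (ℕ; zero; suc; _+_; _*_; _<_; _≤_)
open import Data.Nat.Divisibility using (_∣_; _∣?_)
open import Data.Nat.Coprimality using (Coprime; coprime?)
open import Data.Nat.Primality using (Prime; prime?)
open import Data.Nat.ListAction using (sum)
open import Data.List using (List; filter; length; map; upTo; foldr)
open import Data.Nat using (_⊔_)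
open import Relation.Nullary.Decidable using (_×-dec_)

range1 : ℕ → List ℕ
range1 n = map suc (upTo n)

σ : ℕ → ℕ
σ n = sum (filter (λ d → d ∣? n) (range1 n))

φ : ℕ → ℕ
φ n = length (filter (λ k → coprime? k n) (range1 n))

-- largest prime factor of m (convention: p(1) = 1, as the maximum over an
-- empty set of primes is taken to be 1)
P : ℕ → ℕ
P m = foldr _⊔_ 1 (filter (λ q → prime? q ×-dec (q ∣? m)) (range1 m))

-- n is superabundant: σ(n)/n > σ(m)/m for all 0 < m < n,
-- written with cross-multiplication: σ(m) * n < σ(n) * m
Superabundant : ℕ → Set
Superabundant n = 0 < n × (∀ m → 0 < m → m < n → σ m * n < σ n * m)
  where open import Data.Product using (_×_)

ConsecutiveSA : ℕ → ℕ → Set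
ConsecutiveSA a a' =
  Superabundant a × Superabundant a' × a < a' ×
  (∀ b → a < b → b < a' → ¬ Superabundant b)
  where open import Data.Product using (_×_)
        open import Relation.Nullary using (¬_)

{-# OPTIONS --safe #-}
-- Write σ(n)/φ(n) = (σ(n)/n)·(n/φ(n)). The first factor is larger at a' than at a
-- because a' is superabundant and a < a'. The second factor n/φ(n) = ∏_{p ∣ n} p/(p − 1)
-- only depends on the prime divisors of n, so it suffices that every prime divisor
-- of a divides a'. A superabundant n is divisible by every prime q below a prime
-- divisor p of n: otherwise m = q n / p < n, and σ(m) ≥ (1 + q) σ(n/p) together with
-- σ(n) ≤ (1 + p) σ(n/p) gives σ(m)/m ≥ σ(n)/n. Every prime divisor of a is at most
-- P(a) ≤ P(a'), and P(a') is itself a prime divisor of a'.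
-- The totient comparison is a count: of the numbers 1, …, a a', the a φ(a') ones
-- coprime to a' are all coprime to a, of which there are a' φ(a).
module Submission where

open import Defs
open import Data.Nat
  using (ℕ; zero; suc; _+_; _*_; _<_; _≤_; z≤n; NonZero; NonTrivial;
         nonTrivial⇒n>1; nonTrivial⇒nonZero; nonTrivial⇒≢1;
         >-nonZero; >-nonZero⁻¹; ≢-nonZero⁻¹)
open import Data.Nat.Properties
open import Algebra.Properties.CommutativeSemigroup *-commutativeSemigroup
  using (x∙yz≈y∙xz; x∙yz≈yx∙z; xy∙z≈y∙zx; xy∙z≈x∙zy; xy∙z≈xz∙y)
open import Data.Nat.Divisibility
open import Data.Nat.ListAction using (sum; product)
open import Data.Nat.ListAction.Properties using (sum-++; sum-↭)
open import Data.List using (List; []; _∷_; [_]; _++_; filter; map; upTo; length)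
open import Data.List.Membership.Propositional using (_∈_)
open import Data.List.Membership.Propositional.Properties
  using (∈-∃++; ∈-map⁺; ∈-map⁻; ∈-++⁺ˡ; ∈-++⁺ʳ; ∈-++⁻; ∈-upTo⁺; ∈-filter⁺; ∈-filter⁻;
         foldr-selective)
open import Data.List.Relation.Binary.Subset.Propositional using (_⊆_)
open import Data.List.Relation.Binary.Permutation.Propositional using (↭-sym)
open import Data.List.Relation.Binary.Permutation.Propositional.Properties
  using (shift; ∈-resp-↭)
open import Data.List.Properties using (foldr-forcesᵇ; filter-++; length-++; map-++; upTo-∷ʳ)
import Data.List.Relation.Binary.Sublist.Propositional as Sublist
import Data.List.Relation.Binary.Sublist.Propositional.Properties as Sublist
open import Relation.Unary using (Pred; Decidable)
open import Function.Bundles using (_⇔_; Equivalence; mk⇔)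
open import Data.List.Relation.Unary.All as All using (All; _∷_)
open import Data.List.Relation.Unary.All.Properties using (All¬⇒¬Any)
open import Data.List.Relation.Unary.Any using (here; there)
open import Data.List.Relation.Unary.Unique.Propositional using (Unique; []; _∷_)
import Data.List.Relation.Unary.Unique.Propositional.Properties as Unique
open import Data.Nat.Primality
  using (Prime; prime?; prime⇒nonZero; prime⇒nonTrivial; prime⇒irreducible)
open import Data.Nat.Primality.Factorisation using (factorise)
open import Data.Nat.Coprimality using (Coprime; coprime?; coprime-+; coprime-divisor)
open import Data.Product using (_×_; _,_; proj₂; ∃-syntax)
open import Data.Sum using (inj₁; inj₂)
open import Relation.Nullary using (¬_; yes; no; contradiction)
open import Relation.Nullary.Decidable using (decidable-stable; _×-dec_)
open import Function using (_∘_)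
open import Relation.Binary.PropositionalEquality
  using (_≡_; refl; sym; trans; cong; cong₂; subst; module ≡-Reasoning)

sum-mono-⊆ : ∀ {xs ys : List ℕ} → Unique xs → xs ⊆ ys → sum xs ≤ sum ys
sum-mono-⊆ {[]} _ _ = z≤n
sum-mono-⊆ {x ∷ xs} {ys} (x∉xs ∷ xs-unique) xs⊆ys
  with us , vs , refl ← ∈-∃++ (xs⊆ys (here refl)) = begin
    x + sum xs          ≤⟨ +-monoʳ-≤ x (sum-mono-⊆ xs-unique xs⊆us++vs) ⟩
    sum (x ∷ us ++ vs)  ≡⟨ sum-↭ (↭-sym (shift x us vs)) ⟩
    sum (us ++ x ∷ vs)  ∎
  where
  open ≤-Reasoning
  xs⊆us++vs : xs ⊆ us ++ vs
  xs⊆us++vs z∈xs with ∈-resp-↭ (shift x us vs) (xs⊆ys (there z∈xs))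
  ... | here refl = contradiction z∈xs (All¬⇒¬Any x∉xs)
  ... | there z∈us++vs = z∈us++vs

sum-map-* : ∀ c xs → sum (map (c *_) xs) ≡ c * sum xs
sum-map-* c [] = sym (*-zeroʳ c)
sum-map-* c (x ∷ xs) = trans (cong (c * x +_) (sum-map-* c xs)) (sym (*-distribˡ-+ c x _))

divisors : ℕ → List ℕ
divisors n = filter (_∣? n) (range1 n)

divisors-unique : ∀ n → Unique (divisors n)
divisors-unique n = Unique.filter⁺ (_∣? n) (Unique.map⁺ suc-injective (Unique.upTo⁺ n))

∣⇒∈range1 : ∀ {d n} .{{_ : NonZero n}} → d ∣ n → d ∈ range1 n
∣⇒∈range1 {zero} {n} 0∣n = contradiction (0∣⇒≡0 0∣n) (≢-nonZero⁻¹ n)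
∣⇒∈range1 {suc d} d∣n = ∈-map⁺ suc (∈-upTo⁺ (∣⇒≤ d∣n))

∈-divisors⁺ : ∀ {d n} .{{_ : NonZero n}} → d ∣ n → d ∈ divisors n
∈-divisors⁺ d∣n = ∈-filter⁺ (_∣? _) (∣⇒∈range1 d∣n) d∣n

∈-divisors⁻ : ∀ {d} n → d ∈ divisors n → d ∣ n
∈-divisors⁻ n d∈ = proj₂ (∈-filter⁻ (_∣? n) {xs = range1 n} d∈)

σ-*-≥ : ∀ q t .{{_ : NonZero q}} .{{_ : NonZero t}} → ¬ q ∣ t →
        suc q * σ t ≤ σ (q * t)
σ-*-≥ q t q∤t = begin
  σ t + q * σ t                                    ≡⟨ cong (σ t +_) (sym (sum-map-* q (divisors t))) ⟩
  sum (divisors t) + sum (map (q *_) (divisors t)) ≡⟨ sym (sum-++ (divisors t) _) ⟩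
  sum (divisors t ++ map (q *_) (divisors t))      ≤⟨ sum-mono-⊆ unique ⊆divisors ⟩
  σ (q * t)                                        ∎
  where
  open ≤-Reasoning
  instance
    qt≢0 : NonZero (q * t)
    qt≢0 = m*n≢0 q t
  disjoint : ∀ {v} → ¬ (v ∈ divisors t × v ∈ map (q *_) (divisors t))
  disjoint (d∈ , qe∈) with e , _ , refl ← ∈-map⁻ (q *_) qe∈ =
    q∤t (∣-trans (m∣m*n e) (∈-divisors⁻ t d∈))
  unique : Unique (divisors t ++ map (q *_) (divisors t))
  unique = Unique.++⁺ (divisors-unique t)
             (Unique.map⁺ (*-cancelˡ-≡ _ _ q) (divisors-unique t)) disjoint
  ⊆divisors : divisors t ++ map (q *_) (divisors t) ⊆ divisors (q * t)
  ⊆divisors d∈ with ∈-++⁻ (divisors t) d∈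
  ... | inj₁ d∈t = ∈-divisors⁺ (∣n⇒∣m*n q (∈-divisors⁻ t d∈t))
  ... | inj₂ qe∈ with e , e∈ , refl ← ∈-map⁻ (q *_) qe∈ =
    ∈-divisors⁺ (*-monoʳ-∣ q (∈-divisors⁻ t e∈))

σ-*-prime-≤ : ∀ {p} t .{{_ : NonZero t}} → Prime p → σ (p * t) ≤ suc p * σ t
σ-*-prime-≤ {p} t p-prime = begin
  σ (p * t)                                        ≤⟨ sum-mono-⊆ (divisors-unique (p * t)) split ⟩
  sum (divisors t ++ map (p *_) (divisors t))      ≡⟨ sum-++ (divisors t) _ ⟩
  sum (divisors t) + sum (map (p *_) (divisors t)) ≡⟨ cong (σ t +_) (sum-map-* p (divisors t)) ⟩
  σ t + p * σ t                                    ∎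
  where
  open ≤-Reasoning
  instance
    p≢0 : NonZero p
    p≢0 = prime⇒nonZero p-prime
  split : divisors (p * t) ⊆ divisors t ++ map (p *_) (divisors t)
  split {d} d∈ with p ∣? d
  ... | yes (divides e refl) = subst (_∈ divisors t ++ map (p *_) (divisors t)) (*-comm p e)
          (∈-++⁺ʳ (divisors t) (∈-map⁺ (p *_) (∈-divisors⁺ e∣t)))
    where
    e∣t : e ∣ t
    e∣t = *-cancelˡ-∣ p (subst (_∣ p * t) (*-comm e p) (∈-divisors⁻ (p * t) d∈))
  ... | no p∤d = ∈-++⁺ˡ (∈-divisors⁺ (coprime-divisor d⊥p (∈-divisors⁻ (p * t) d∈)))
    where
    d⊥p : Coprime d p
    d⊥p (i∣d , i∣p) with prime⇒irreducible p-prime i∣p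
    ... | inj₁ i≡1 = i≡1
    ... | inj₂ refl = contradiction i∣d p∤d

q[1+p]≤p[1+q] : ∀ {q p} s → q ≤ p → q * (suc p * s) ≤ p * (suc q * s)
q[1+p]≤p[1+q] {q} {p} s q≤p = begin
  q * (suc p * s)     ≡⟨ *-distribˡ-+ q s (p * s) ⟩
  q * s + q * (p * s) ≡⟨ cong (q * s +_) (x∙yz≈y∙xz q p s) ⟩
  q * s + p * (q * s) ≤⟨ +-monoˡ-≤ (p * (q * s)) (*-monoˡ-≤ s q≤p) ⟩
  p * s + p * (q * s) ≡⟨ *-distribˡ-+ p s (q * s) ⟨
  p * (suc q * s)     ∎
  where open ≤-Reasoning

superabundant-∣-smaller-prime : ∀ {n q p} → Superabundant n → Prime q → Prime p →
                                q ≤ p → p ∣ n → q ∣ n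
superabundant-∣-smaller-prime {q = q} {p} (0<n , maximal) q-prime p-prime q≤p (divides t refl) =
  decidable-stable (q ∣? t * p) λ q∤n → <⇒≱ (maximal (q * t) 0<qt (qt<tp q∤n)) (σ-swap q∤n)
  where
  instance
    t≢0 : NonZero t
    t≢0 = m*n≢0⇒m≢0 t {{>-nonZero 0<n}}
    q≢0 : NonZero q
    q≢0 = prime⇒nonZero q-prime
  0<qt : 0 < q * t
  0<qt = >-nonZero⁻¹ (q * t) {{m*n≢0 q t}}
  qt<tp : ¬ q ∣ t * p → q * t < t * p
  qt<tp q∤n = subst (q * t <_) (*-comm p t)
    (*-monoˡ-< t (≤∧≢⇒< q≤p λ { refl → q∤n (n∣m*n t) }))
  σ-swap : ¬ q ∣ t * p → σ (t * p) * (q * t) ≤ σ (q * t) * (t * p)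
  σ-swap q∤n = begin
    σ (t * p) * (q * t)       ≡⟨ cong (λ m → σ m * (q * t)) (*-comm t p) ⟩
    σ (p * t) * (q * t)       ≡⟨ x∙yz≈yx∙z (σ (p * t)) q t ⟩
    q * σ (p * t) * t         ≤⟨ *-monoˡ-≤ t (*-monoʳ-≤ q (σ-*-prime-≤ t p-prime)) ⟩
    q * (suc p * σ t) * t     ≤⟨ *-monoˡ-≤ t (q[1+p]≤p[1+q] (σ t) q≤p) ⟩
    p * (suc q * σ t) * t     ≤⟨ *-monoˡ-≤ t (*-monoʳ-≤ p (σ-*-≥ q t (q∤n ∘ ∣m⇒∣m*n p))) ⟩
    p * σ (q * t) * t         ≡⟨ xy∙z≈y∙zx p (σ (q * t)) t ⟩
    σ (q * t) * (t * p)       ∎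
    where open ≤-Reasoning

primeDivisors : ℕ → List ℕ
primeDivisors m = filter (λ q → prime? q ×-dec (q ∣? m)) (range1 m)

prime∣⇒≤P : ∀ {q m} .{{_ : NonZero m}} → Prime q → q ∣ m → q ≤ P m
prime∣⇒≤P {q} {m} q-prime q∣m = All.lookup bounded q∈
  where
  bounded : All (_≤ P m) (primeDivisors m)
  bounded = foldr-forcesᵇ (λ x y x⊔y≤ → m⊔n≤o⇒m≤o x y x⊔y≤ , m⊔n≤o⇒n≤o x y x⊔y≤)
              1 (primeDivisors m) ≤-refl
  q∈ : q ∈ primeDivisors m
  q∈ = ∈-filter⁺ (λ q → prime? q ×-dec (q ∣? m))
         (∣⇒∈range1 q∣m) (q-prime , q∣m)

P-prime-divisor : ∀ m → 1 < P m → Prime (P m) × P m ∣ m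
P-prime-divisor m 1<Pm with foldr-selective ⊔-sel 1 (primeDivisors m)
... | inj₁ Pm≡1 = contradiction Pm≡1 (>⇒≢ 1<Pm)
... | inj₂ Pm∈ = proj₂ (∈-filter⁻ (λ q → prime? q ×-dec (q ∣? m)) {xs = range1 m} Pm∈)

superabundant-∣-prime-divisors : ∀ {a a'} .{{_ : NonZero a}} → Superabundant a' →
                                 P a ≤ P a' → ∀ {q} → Prime q → q ∣ a → q ∣ a'
superabundant-∣-prime-divisors {a} {a'} sa Pa≤Pa' {q} q-prime q∣a =
  let q≤Pa' = ≤-trans (prime∣⇒≤P q-prime q∣a) Pa≤Pa'
      1<q = nonTrivial⇒n>1 q {{prime⇒nonTrivial q-prime}}
      Pa'-prime , Pa'∣a' = P-prime-divisor a' (<-≤-trans 1<q q≤Pa')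
  in superabundant-∣-smaller-prime sa q-prime Pa'-prime q≤Pa' Pa'∣a'

range1-suc : ∀ n → range1 (suc n) ≡ range1 n ++ [ suc n ]
range1-suc n = trans (cong (map suc) (sym (upTo-∷ʳ n))) (map-++ suc (upTo n) [ n ])

module _ {ℓ} {Q : Pred ℕ ℓ} (Q? : Decidable Q) where

  count : ℕ → ℕ
  count n = length (filter Q? (range1 n))

  count-suc : ∀ n → count (suc n) ≡ count n + length (filter Q? [ suc n ])
  count-suc n = begin
    length (filter Q? (range1 (suc n)))                     ≡⟨ cong (length ∘ filter Q?) (range1-suc n) ⟩
    length (filter Q? (range1 n ++ [ suc n ]))              ≡⟨ cong length (filter-++ Q? (range1 n) _) ⟩
    length (filter Q? (range1 n) ++ filter Q? [ suc n ])    ≡⟨ length-++ (filter Q? (range1 n)) ⟩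
    count n + length (filter Q? [ suc n ])                  ∎
    where open ≡-Reasoning

  length-filter-[-]-cong : ∀ {x y} → Q x ⇔ Q y →
                           length (filter Q? [ x ]) ≡ length (filter Q? [ y ])
  length-filter-[-]-cong {x} {y} Qx⇔Qy with Q? x | Q? y
  ... | yes _   | yes _   = refl
  ... | no _    | no _    = refl
  ... | yes Qx  | no ¬Qy  = contradiction (Equivalence.to Qx⇔Qy Qx) ¬Qy
  ... | no ¬Qx  | yes Qy  = contradiction (Equivalence.from Qx⇔Qy Qy) ¬Qx

  module _ {m} (periodic : ∀ k → Q (m + k) ⇔ Q k) where

    count-+ : ∀ k → count (m + k) ≡ count m + count k
    count-+ zero = trans (cong count (+-identityʳ m)) (sym (+-identityʳ (count m)))
    count-+ (suc k) = begin
      count (m + suc k)                                          ≡⟨ cong count (+-suc m k) ⟩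
      count (suc (m + k))                                        ≡⟨ count-suc (m + k) ⟩
      count (m + k) + length (filter Q? [ suc (m + k) ])         ≡⟨ cong₂ _+_ (count-+ k) step ⟩
      count m + count k + length (filter Q? [ suc k ])           ≡⟨ +-assoc (count m) _ _ ⟩
      count m + (count k + length (filter Q? [ suc k ]))         ≡⟨ cong (count m +_) (count-suc k) ⟨
      count m + count (suc k)                                    ∎
      where
      open ≡-Reasoning
      step : length (filter Q? [ suc (m + k) ]) ≡ length (filter Q? [ suc k ])
      step = length-filter-[-]-cong (subst (λ x → Q x ⇔ Q (suc k)) (+-suc m k) (periodic (suc k)))

    count-* : ∀ y → count (y * m) ≡ y * count m
    count-* zero = refl
    count-* (suc y) = trans (count-+ (y * m)) (cong (count m +_) (count-* y))

count-mono : ∀ {ℓ₁ ℓ₂} {Q : Pred ℕ ℓ₁} {R : Pred ℕ ℓ₂} (Q? : Decidable Q) (R? : Decidable R) →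
             (∀ {x} → Q x → R x) → ∀ n → count Q? n ≤ count R? n
count-mono Q? R? Q⇒R n =
  Sublist.length-mono-≤ (Sublist.filter⁺ Q? R? (λ { refl → Q⇒R }) (Sublist.⊆-refl {x = range1 n}))

coprime-+-period : ∀ x k → Coprime (x + k) x ⇔ Coprime k x
coprime-+-period x k = mk⇔
  (λ coprime {i} (i∣k , i∣x) → coprime (∣m∣n⇒∣m+n i∣x i∣k , i∣x))
  coprime-+

∃-prime-divisor : ∀ n .{{_ : NonTrivial n}} → ∃[ q ] Prime q × q ∣ n
∃-prime-divisor n with factorise n {{nonTrivial⇒nonZero n}}
... | record { factors = [] ; isFactorisation = n≡1 } = contradiction n≡1 nonTrivial⇒≢1
... | record { factors = q ∷ qs ; isFactorisation = n≡qΠqs ; factorsPrime = q-prime ∷ _ } =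
  q , q-prime , subst (q ∣_) (sym n≡qΠqs) (m∣m*n (product qs))

coprime-prime-divisors-⊆ : ∀ {k m n} .{{_ : NonZero n}} →
                           (∀ {q} → Prime q → q ∣ n → q ∣ m) → Coprime k m → Coprime k n
coprime-prime-divisors-⊆ {n = n} _ _ {zero} (_ , 0∣n) = contradiction (0∣⇒≡0 0∣n) (≢-nonZero⁻¹ n)
coprime-prime-divisors-⊆ _ _ {1} _ = refl
coprime-prime-divisors-⊆ n⊆m k⊥m {i@(suc (suc _))} (i∣k , i∣n)
  with q , q-prime , q∣i ← ∃-prime-divisor i =
  contradiction (k⊥m (∣-trans q∣i i∣k , n⊆m q-prime (∣-trans q∣i i∣n)))
                (nonTrivial⇒≢1 {{prime⇒nonTrivial q-prime}})

coprimeTo? : ∀ x → Decidable (λ k → Coprime k x)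
coprimeTo? x k = coprime? k x

*φ-mono : ∀ {a a'} .{{_ : NonZero a}} → (∀ {q} → Prime q → q ∣ a → q ∣ a') →
          a * φ a' ≤ a' * φ a
*φ-mono {a} {a'} a⊆a' = begin
  a * φ a'                        ≡⟨ count-* (coprimeTo? a') (coprime-+-period a') a ⟨
  count (coprimeTo? a') (a * a')  ≤⟨ count-mono (coprimeTo? a') (coprimeTo? a)
                                       (coprime-prime-divisors-⊆ a⊆a') (a * a') ⟩
  count (coprimeTo? a) (a * a')   ≡⟨ cong (count (coprimeTo? a)) (*-comm a a') ⟩
  count (coprimeTo? a) (a' * a)   ≡⟨ count-* (coprimeTo? a) (coprime-+-period a) a' ⟩
  a' * φ a                        ∎
  where open ≤-Reasoning

mainTheorem15 : ∀ a a' → ConsecutiveSA a a' → P a ≤ P a' →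
    σ a * φ a' ≤ σ a' * φ a
mainTheorem15 a a' ((0<a , _) , sa'@(_ , maximal) , a<a' , _) Pa≤Pa' =
  *-cancelʳ-≤ (σ a * φ a') (σ a' * φ a) a (begin
    σ a * φ a' * a    ≡⟨ xy∙z≈x∙zy (σ a) (φ a') a ⟩
    σ a * (a * φ a')  ≤⟨ *-monoʳ-≤ (σ a) (*φ-mono (superabundant-∣-prime-divisors sa' Pa≤Pa')) ⟩
    σ a * (a' * φ a)  ≡⟨ *-assoc (σ a) a' (φ a) ⟨
    σ a * a' * φ a    ≤⟨ *-monoˡ-≤ (φ a) (<⇒≤ (maximal a 0<a a<a')) ⟩
    σ a' * a * φ a    ≡⟨ xy∙z≈xz∙y (σ a') a (φ a) ⟩
    σ a' * φ a * a    ∎)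
  where
  open ≤-Reasoning
  instance
    a≢0 : NonZero a
    a≢0 = >-nonZero 0<a
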